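{- For all positive integers $d$ and $k$ and every graph $G$ with $\alpha^{\mathrm{loc}}(G)\le d$ and $\mathrm{rw}(G)\le k$, we have $\alpha\text{ - }\mathrm{tw}(G)\le 3dk$.
   Context: All graphs finite and simple. $\alpha^{\mathrm{loc}}(G)=\max_{v\in V(G)}\alpha(G[N[v]])$, $\alpha$ the independence number. $\alpha\text{ - }\mathrm{tw}(G)$ is the minimum over tree-decompositions $(T,\beta)$ of $G$ of $\max_{t}\alpha(G[\beta(t)])$. A rank-decomposition of $G$ is a pair $(T,\delta)$ with $T$ a tree whose internal nodes have degree 3 and $\delta$ a bijection from the leaves of $T$ to $V(G)$; for an edge $e$ of $T$, with $X_e$ the image under $\delta$ of the leaves in one component of $T-e$, the cutrank of $e$ is the $\mathbb{F}_2$-rank of the submatrix of the adjacency matrix with rows $X_e$ and columns $V(G)\setminus X_e$; the width is the maximum cutrank over edges of $T$, and $\mathrm{rw}(G)$ is the minimum width of a rank-decomposition of $G$. -}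

module Defs where

open import Data.Nat using (ℕ; zero; suc; _≤_; _*_)
open import Data.Bool using (Bool; true; false; _∧_; _∨_; _xor_)
open import Data.Fin using (Fin; zero; suc; toℕ; _≟_)
open import Data.Fin.Subset using (Subset; _∈_; _∉_; _⊆_; ∣_∣)
open import Data.Vec using (Vec; []; _∷_; tabulate)
open import Data.List using (length; filter; allFin)
open import Data.Product using (Σ; Σ-syntax; _×_; ∃; ∃-syntax; _,_)
open import Data.Sum using (_⊎_)
open import Relation.Nullary using (¬_)
open import Relation.Nullary.Decidable using (⌊_⌋)
open import Relation.Binary.PropositionalEquality using (_≡_)
open import Function.Definitions using (Injective)

record Graph : Set where
  field
    n     : ℕ
    adj   : Fin n → Fin n → Bool
    sym   : ∀ u v → adj u v ≡ adj v u
    irrefl : ∀ v → adj v v ≡ false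
open Graph public

IndepIn : (G : Graph) → Subset (n G) → Subset (n G) → Set
IndepIn G S I = I ⊆ S × (∀ u v → u ∈ I → v ∈ I → adj G u v ≡ false)

αLe : (G : Graph) → Subset (n G) → ℕ → Set
αLe G S m = ∀ I → IndepIn G S I → ∣ I ∣ ≤ m

N[_] : {G : Graph} → Fin (n G) → Subset (n G)
N[_] {G} v = tabulate (λ w → ⌊ w ≟ v ⌋ ∨ adj G v w)

αlocLe : Graph → ℕ → Set
αlocLe G d = ∀ v → αLe G (N[_] {G} v) d

-- Finite trees, encoded as rooted trees on nodes Fin (suc m) with root
-- zero, where node (suc i) has parent (par i) of smaller index.

record Tree : Set where
  field
    m    : ℕ
    par  : Fin m → Fin (suc m)
    par< : ∀ i → toℕ (par i) ≤ toℕ i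
open Tree public

Node : Tree → Set
Node T = Fin (suc (m T))

TAdj : (T : Tree) → Node T → Node T → Set
TAdj T s t = (Σ[ i ∈ Fin (m T) ] (s ≡ suc i × t ≡ par T i))
           ⊎ (Σ[ i ∈ Fin (m T) ] (t ≡ suc i × s ≡ par T i))

data WalkIn (T : Tree) (P : Node T → Set) : Node T → Node T → Set where
  []  : ∀ {s} → WalkIn T P s s
  _∷_ : ∀ {s u t} → TAdj T s u × P u → WalkIn T P u t → WalkIn T P s t

ConnectedIn : (T : Tree) → (Node T → Set) → Set
ConnectedIn T P = ∀ s t → P s → P t → WalkIn T P s t

record TreeDecomposition (G : Graph) : Set where
  field
    tree : Tree
    bag  : Node tree → Subset (n G)
    cover-vertices : ∀ v → ∃[ t ] (v ∈ bag t)
    cover-edges    : ∀ u v → adj G u v ≡ true → ∃[ t ] (u ∈ bag t × v ∈ bag t)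
    connected      : ∀ v → ConnectedIn tree (λ t → v ∈ bag t)
open TreeDecomposition public

αtwLe : Graph → ℕ → Set
αtwLe G w = Σ[ D ∈ TreeDecomposition G ] (∀ t → αLe G (bag D t) w)

degree : (T : Tree) → Node T → ℕ
degree T t = length (filter (λ i → par T i ≟ t) (allFin (m T))) + up t
  where
    open import Data.Nat using (_+_)
    up : Node T → ℕ
    up zero = 0
    up (suc _) = 1

data Below (T : Tree) (s : Node T) : Node T → Set where
  here  : Below T s s
  there : ∀ i → Below T s (par T i) → Below T s (suc i)

xorsum : ∀ {k} → Subset k → (Fin k → Bool) → Bool
xorsum [] f = false
xorsum (b ∷ S) f = (b ∧ f zero) xor xorsum S (λ v → f (suc v))

-- The rows indexed by R ⊆ X of the F₂-matrix A_G[X, V∖X] are linearly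
-- independent: the only subset of them summing to zero is the empty one.
RowsIndep : (G : Graph) → (Fin (n G) → Set) → Subset (n G) → Set
RowsIndep G X R =
  ∀ S → S ⊆ R →
  (∀ w → ¬ X w → xorsum S (λ v → adj G v w) ≡ false) →
  ∀ v → v ∉ S

-- cutrank_G(X) ≤ k : the F₂-rank (max number of linearly independent rows)
-- of A_G[X, V∖X] is at most k
CutRankLe : (G : Graph) → (Fin (n G) → Set) → ℕ → Set
CutRankLe G X k = ∀ R → (∀ v → v ∈ R → X v) → RowsIndep G X R → ∣ R ∣ ≤ k

record RankDecomposition (G : Graph) : Set where
  field
    tree : Tree
    -- internal nodes (degree ≥ 2) have degree 3; leaves = nodes of degree ≤ 1
    cubic : ∀ t → 2 ≤ degree tree t → degree tree t ≡ 3
    -- leaf : V(G) → leaves(T) is the inverse of the bijection δ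
    leaf  : Fin (n G) → Node tree
    leaf-inj  : Injective _≡_ _≡_ leaf
    leaf-isLeaf : ∀ v → degree tree (leaf v) ≤ 1
    leaf-onto : ∀ t → degree tree t ≤ 1 → ∃[ v ] (leaf v ≡ t)
open RankDecomposition public

-- width ≤ k: for every edge e = {suc i, par i} of T, the side X_e formed by
-- vertices mapped into the subtree below suc i has cutrank ≤ k
widthLe : {G : Graph} → RankDecomposition G → ℕ → Set
widthLe {G} D k =
  ∀ i → CutRankLe G (λ v → Below (tree D) (suc i) (leaf D v)) k

rwLe : Graph → ℕ → Set
rwLe G k = Σ[ D ∈ RankDecomposition G ] widthLe D k

-- Take the tree T of a rank-decomposition of width ≤ k and put into the bag of a node t every vertex v
-- such that t lies on the subtree of T spanned by the leaves of N[v]; this is a tree-decomposition.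
-- At a leaf t = leaf w every bag vertex is in N[w], so α ≤ d. At an internal node, an independent set
-- I of the bag splits by the three edges at t into the parts lying on the far side of each edge, and
-- each vertex of such a part has a neighbour across that edge. A greedy choice of pairs (vertex,
-- neighbour across the cut), discarding the ≤ d vertices of I adjacent to each chosen partner, turns
-- more than d·k vertices of a part into k + 1 rows of the cut matrix forming a triangular submatrix
-- with ones on the diagonal, contradicting cutrank ≤ k. Hence α(bag) ≤ 3dk.

module Submission where

open import Defs
open import Data.Bool using (Bool; true; false; _∧_; _∨_; _xor_)
open import Data.Bool.Properties using (∨-zeroʳ; ¬-not)
open import Data.Fin using (Fin; zero; suc; _≟_; toℕ)
open import Data.Fin.Properties using (suc-injective; any?)
open import Data.Fin.Subset
  using (Subset; outside; inside; _∈_; _∉_; _⊆_; ∣_∣; ⊥; ⁅_⁆; _∪_; _∩_; _─_; _-_; ⋃; Nonempty)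
open import Data.Fin.Subset.Properties
  using ( _∈?_; ∉⊥; x∈⁅x⁆; x∈⁅y⁆⇒x≡y; drop-there; nonempty?; Empty-unique; ⊆-refl; ⊆-trans; ⊆-min
        ; x∈p∪q⁺; x∈p∪q⁻; x∈p∩q⁺; x∈p∩q⁻; p∩q⊆p; p∩q⊆q; x∈p∧x∉q⇒x∈p─q; x∈p∧x≢y⇒x∈p-y; p─q⊆p
        ; ∣⊥∣≡0; ∣p∣≤∣x∷p∣; p⊆q⇒∣p∣≤∣q∣; p⊂q⇒∣p∣<∣q∣)
open import Data.List as List using (List; []; _∷_; length; filter; allFin)
open import Data.List.Properties using (length-map)
open import Data.List.Membership.Propositional using () renaming (_∈_ to _∈ₗ_)
open import Data.List.Membership.Propositional.Properties using (∈-length; ∈-filter⁺; ∈-filter⁻; ∈-allFin)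
open import Data.List.Relation.Unary.All as All using (All; []; _∷_)
import Data.List.Relation.Unary.All.Properties as All
open import Data.List.Relation.Unary.Any as Any using (Any)
import Data.List.Relation.Unary.Any.Properties as Any
open import Data.Nat using (ℕ; zero; suc; _≤_; _<_; _+_; _*_; z≤n; s≤s; _≤?_; >-nonZero)
open import Data.Nat.Induction using (<-wellFounded)
open import Data.Nat.Properties
  using ( ≤-refl; ≤-trans; ≤-<-trans; <⇒≢; <⇒≱; ≮⇒≥; ≰⇒>; n≤1+n; m≤m+n; m≤m*n; +-suc; +-identityʳ
        ; +-monoˡ-≤; +-monoʳ-≤; +-mono-≤; +-cancelˡ-<; *-suc; *-assoc; *-distribʳ-+; module ≤-Reasoning)
open import Data.Product using (_×_; ∃-syntax; ∃₂; _,_; proj₂; map₁; map₂)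
open import Data.Sum using (_⊎_; inj₁; inj₂; swap; [_,_]′)
open import Data.Vec using (_∷_; []; tabulate; _[_]=_)
open _[_]=_ using (here; there)
open import Data.Vec.Properties using (lookup∘tabulate; []=⇒lookup; lookup⇒[]=)
open import Function using (_∘_)
open import Induction.WellFounded using (Acc; acc)
open import Level using (0ℓ)
open import Relation.Binary.PropositionalEquality
  using (_≡_; _≢_; refl; cong; cong₂; trans; subst) renaming (sym to ≡-sym)
open import Relation.Nullary using (¬_; Dec; yes; no; does; contradiction)
open import Relation.Nullary.Decidable
  using (dec-true; dec-false; decidable-stable; isYes; _⊎-dec_; _×-dec_; ¬?)
open import Relation.Unary using (Pred; Decidable)

private
  variable
    k : ℕ

∈-tabulate⁺ : ∀ {f : Fin k → Bool} {x} → f x ≡ true → x ∈ tabulate f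
∈-tabulate⁺ {f = f} {x} fx = lookup⇒[]= x (tabulate f) (trans (lookup∘tabulate f x) fx)

∈-tabulate⁻ : ∀ {f : Fin k → Bool} {x} → x ∈ tabulate f → f x ≡ true
∈-tabulate⁻ {f = f} {x} x∈ = trans (≡-sym (lookup∘tabulate f x)) ([]=⇒lookup x∈)

⟦_⟧ : {P : Pred (Fin k) 0ℓ} → Decidable P → Subset k
⟦ P? ⟧ = tabulate (λ x → does (P? x))

∈⟦⟧⁺ : {P : Pred (Fin k) 0ℓ} (P? : Decidable P) {x : Fin k} → P x → x ∈ ⟦ P? ⟧
∈⟦⟧⁺ P? {x} px = ∈-tabulate⁺ (dec-true (P? x) px)

∈⟦⟧⁻ : {P : Pred (Fin k) 0ℓ} (P? : Decidable P) {x : Fin k} → x ∈ ⟦ P? ⟧ → P x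
∈⟦⟧⁻ P? {x} x∈ = decidable-stable (P? x) λ ¬px →
  true≢false (trans (≡-sym (∈-tabulate⁻ x∈)) (dec-false (P? x) ¬px))
  where
    true≢false : true ≢ false
    true≢false ()

x∈p─q⇒x∉q : ∀ (p q : Subset k) {x} → x ∈ p ─ q → x ∉ q
x∈p─q⇒x∉q (s ∷ p) (inside ∷ q) () here
x∈p─q⇒x∉q (s ∷ p) (t ∷ q) (there x∈) (there x∈q) = x∈p─q⇒x∉q p q x∈ x∈q

x∉p-x : ∀ (p : Subset k) x → x ∉ p - x
x∉p-x (s ∷ p) zero ()
x∉p-x (s ∷ p) (suc x) (there x∈) = x∉p-x p x x∈

∪⁅⁆⁻ : ∀ (p : Subset k) {a x} → x ∈ p ∪ ⁅ a ⁆ → x ∈ p ⊎ x ≡ a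
∪⁅⁆⁻ p {a} x∈ with x∈p∪q⁻ p ⁅ a ⁆ x∈
... | inj₁ x∈p = inj₁ x∈p
... | inj₂ x∈a = inj₂ (x∈⁅y⁆⇒x≡y a x∈a)

∀-∪⁅⁆ : ∀ {P : Fin k → Set} {p : Subset k} {a} →
        (∀ x → x ∈ p → P x) → P a → ∀ x → x ∈ p ∪ ⁅ a ⁆ → P x
∀-∪⁅⁆ {p = p} all-p pa x x∈ with ∪⁅⁆⁻ p x∈
... | inj₁ x∈p  = all-p x x∈p
... | inj₂ refl = pa

∪⁅⁆-⊆ : ∀ {p q : Subset k} {a} → p ⊆ q → a ∈ q → p ∪ ⁅ a ⁆ ⊆ q
∪⁅⁆-⊆ {p = p} p⊆q a∈q x∈ with ∪⁅⁆⁻ p x∈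
... | inj₁ x∈p  = p⊆q x∈p
... | inj₂ refl = a∈q

∣p∣<∣p∪⁅x⁆∣ : ∀ {p : Subset k} {x} → x ∉ p → ∣ p ∣ < ∣ p ∪ ⁅ x ⁆ ∣
∣p∣<∣p∪⁅x⁆∣ {x = x} x∉p = p⊂q⇒∣p∣<∣q∣ (x∈p∪q⁺ ∘ inj₁ , x , x∈p∪q⁺ (inj₂ (x∈⁅x⁆ x)) , x∉p)

0<∣p∣⇒Nonempty : ∀ {p : Subset k} → 0 < ∣ p ∣ → Nonempty p
0<∣p∣⇒Nonempty {k} {p} 0<∣p∣ = decidable-stable (nonempty? p) λ empty →
  <⇒≢ 0<∣p∣ (≡-sym (trans (cong ∣_∣ (Empty-unique empty)) (∣⊥∣≡0 k)))

∈-∈-≢⇒2≤length : ∀ {A : Set} {x y : A} {xs} → x ∈ₗ xs → y ∈ₗ xs → x ≢ y → 2 ≤ length xs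
∈-∈-≢⇒2≤length (Any.here refl) (Any.here refl) x≢y = contradiction refl x≢y
∈-∈-≢⇒2≤length (Any.here _)   (Any.there y∈)  _   = s≤s (∈-length y∈)
∈-∈-≢⇒2≤length (Any.there x∈) (Any.here _)    _   = s≤s (∈-length x∈)
∈-∈-≢⇒2≤length (Any.there x∈) (Any.there y∈) x≢y = ≤-trans (∈-∈-≢⇒2≤length x∈ y∈ x≢y) (n≤1+n _)

∣p∪q∣≤∣p∣+∣q∣ : ∀ (p q : Subset k) → ∣ p ∪ q ∣ ≤ ∣ p ∣ + ∣ q ∣
∣p∪q∣≤∣p∣+∣q∣ [] [] = z≤n
∣p∪q∣≤∣p∣+∣q∣ (outside ∷ p) (outside ∷ q) = ∣p∪q∣≤∣p∣+∣q∣ p q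
∣p∪q∣≤∣p∣+∣q∣ (outside ∷ p) (inside ∷ q) =
  subst (suc ∣ p ∪ q ∣ ≤_) (≡-sym (+-suc ∣ p ∣ ∣ q ∣)) (s≤s (∣p∪q∣≤∣p∣+∣q∣ p q))
∣p∪q∣≤∣p∣+∣q∣ (inside ∷ p) (s ∷ q) =
  s≤s (≤-trans (∣p∪q∣≤∣p∣+∣q∣ p q) (+-monoʳ-≤ ∣ p ∣ (∣p∣≤∣x∷p∣ s q)))

∣p∣≤∣q∣+∣r∣ : ∀ {p q r : Subset k} → p ⊆ q ∪ r → ∣ p ∣ ≤ ∣ q ∣ + ∣ r ∣
∣p∣≤∣q∣+∣r∣ {q = q} {r} p⊆q∪r = ≤-trans (p⊆q⇒∣p∣≤∣q∣ p⊆q∪r) (∣p∪q∣≤∣p∣+∣q∣ q r)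

∈⋃⁺ : ∀ {ps : List (Subset k)} {x} → Any (x ∈_) ps → x ∈ ⋃ ps
∈⋃⁺ {ps = p ∷ ps} (Any.here x∈p)  = x∈p∪q⁺ (inj₁ x∈p)
∈⋃⁺ {ps = p ∷ ps} (Any.there x∈) = x∈p∪q⁺ (inj₂ (∈⋃⁺ x∈))

∣⋃∣≤length* : ∀ {ps : List (Subset k)} {D} → All (λ p → ∣ p ∣ ≤ D) ps → ∣ ⋃ ps ∣ ≤ length ps * D
∣⋃∣≤length* {k} {ps = []} [] = subst (_≤ 0) (≡-sym (∣⊥∣≡0 k)) ≤-refl
∣⋃∣≤length* {ps = p ∷ ps} (∣p∣≤D ∷ bounds) =
  ≤-trans (∣p∪q∣≤∣p∣+∣q∣ p (⋃ ps)) (+-mono-≤ ∣p∣≤D (∣⋃∣≤length* bounds))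

xorsum-false : ∀ (S : Subset k) f → (∀ v → v ∈ S → f v ≡ false) → xorsum S f ≡ false
xorsum-false [] f zeros = refl
xorsum-false (outside ∷ S) f zeros = xorsum-false S (f ∘ suc) (λ v → zeros (suc v) ∘ there)
xorsum-false (inside ∷ S) f zeros
  rewrite zeros zero here = xorsum-false S (f ∘ suc) (λ v → zeros (suc v) ∘ there)

∧-congʳ-true : ∀ {s s′ b : Bool} → (s ≡ true → b ≡ true → s′ ≡ true) → (s′ ≡ true → b ≡ true → s ≡ true) →
               s ∧ b ≡ s′ ∧ b
∧-congʳ-true {false} {false}         _  _    = refl
∧-congʳ-true {true}  {true}          _  _    = refl
∧-congʳ-true {true}  {false} {false} _  _    = refl
∧-congʳ-true {false} {true}  {false} _  _    = refl
∧-congʳ-true {true}  {false} {true}  to _    with () ← to refl refl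
∧-congʳ-true {false} {true}  {true}  _  from with () ← from refl refl

xorsum-cong : ∀ (S S′ : Subset k) f → (∀ v → v ∈ S → f v ≡ true → v ∈ S′) →
              (∀ v → v ∈ S′ → f v ≡ true → v ∈ S) → xorsum S f ≡ xorsum S′ f
xorsum-cong [] [] f to from = refl
xorsum-cong (s ∷ S) (s′ ∷ S′) f to from =
  cong₂ _xor_ (∧-congʳ-true (λ s≡ f0 → []=⇒lookup (to zero (lookup⇒[]= zero (s ∷ S) s≡) f0))
                            (λ s′≡ f0 → []=⇒lookup (from zero (lookup⇒[]= zero (s′ ∷ S′) s′≡) f0)))
              (xorsum-cong S S′ (f ∘ suc) (λ v v∈S fv → drop-there (to (suc v) (there v∈S) fv))
                                          (λ v v∈S′ fv → drop-there (from (suc v) (there v∈S′) fv)))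

xorsum-pivot : ∀ (S : Subset k) f {a} → f a ≡ true → (∀ v → v ∈ S → f v ≡ true → v ≡ a) →
               xorsum S f ≡ false → a ∉ S
xorsum-pivot (inside ∷ S) f {zero} f0 unique sum here =
  contradiction (trans (≡-sym (cong₂ (λ x y → (true ∧ x) xor y) f0 rest)) sum) λ ()
  where
    rest : xorsum S (f ∘ suc) ≡ false
    rest = xorsum-false S (f ∘ suc) λ v v∈S → ¬-not λ fv → contradiction (unique (suc v) (there v∈S) fv) λ ()
xorsum-pivot (s ∷ S) f {suc a} fa unique sum (there a∈S) =
  xorsum-pivot S (f ∘ suc) fa (λ v v∈S fv → suc-injective (unique (suc v) (there v∈S) fv))
    (trans (≡-sym (cong (_xor xorsum S (f ∘ suc)) head)) sum) a∈S
  where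
    head : s ∧ f zero ≡ false
    head = ∧-congʳ-true (λ s≡ f0 → contradiction (unique zero (lookup⇒[]= zero (s ∷ S) s≡) f0) λ ()) λ ()

Independent : (G : Graph) → Subset (n G) → Set
Independent G I = ∀ u v → u ∈ I → v ∈ I → adj G u v ≡ false

HasNeighbour : (G : Graph) → (Fin (n G) → Set) → Fin (n G) → Set
HasNeighbour G P v = ∃[ u ] (P u × adj G v u ≡ true)

Independent-⊆ : ∀ G {I J} → J ⊆ I → Independent G I → Independent G J
Independent-⊆ G J⊆I I-indep u v u∈J v∈J = I-indep u v (J⊆I u∈J) (J⊆I v∈J)

module Neighbourhood (G : Graph) where

  N : Fin (n G) → Subset (n G)
  N = N[_] {G}

  v∈N[v] : ∀ v → v ∈ N v
  v∈N[v] v = ∈-tabulate⁺ (diagonal (v ≟ v))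
    where
      diagonal : (v≟v : Dec (v ≡ v)) → isYes v≟v ∨ adj G v v ≡ true
      diagonal (yes _)  = refl
      diagonal (no v≢v) = contradiction refl v≢v

  adj⇒∈N : ∀ {u v} → adj G v u ≡ true → u ∈ N v
  adj⇒∈N {u} {v} vu = ∈-tabulate⁺ (trans (cong (isYes (u ≟ v) ∨_) vu) (∨-zeroʳ _))

  ∉N⇒¬adj : ∀ {u v} → u ∉ N v → adj G v u ≡ false
  ∉N⇒¬adj u∉N = ¬-not (u∉N ∘ adj⇒∈N)

  ∈N⇒≡⊎adj : ∀ {u v} → u ∈ N v → u ≡ v ⊎ adj G v u ≡ true
  ∈N⇒≡⊎adj {u} {v} u∈N with u ≟ v | ∈-tabulate⁻ u∈N
  ... | yes u≡v | _  = inj₁ u≡v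
  ... | no _    | vu = inj₂ vu

  ∈N⇒adj : ∀ {u v} → u ∈ N v → u ≢ v → adj G v u ≡ true
  ∈N⇒adj u∈N u≢v with ∈N⇒≡⊎adj u∈N
  ... | inj₁ u≡v = contradiction u≡v u≢v
  ... | inj₂ vu  = vu

  ∈N-sym : ∀ {u v} → u ∈ N v → v ∈ N u
  ∈N-sym {u} {v} u∈N with ∈N⇒≡⊎adj u∈N
  ... | inj₁ refl = v∈N[v] u
  ... | inj₂ vu   = adj⇒∈N (trans (sym G u v) vu)

RowsIndepOn : (G : Graph) → Subset (n G) → Subset (n G) → Set
RowsIndepOn G C R =
  ∀ S → S ⊆ R → (∀ w → w ∈ C → xorsum S (λ v → adj G v w) ≡ false) → ∀ v → v ∉ S

module _ (G : Graph) where

  RowsIndepOn-⊥ : ∀ C → RowsIndepOn G C ⊥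
  RowsIndepOn-⊥ C S S⊆⊥ _ v = ∉⊥ ∘ S⊆⊥

  RowsIndepOn-addPivotColumn : ∀ {C R a b} → RowsIndepOn G C R → (∀ r → r ∈ R → adj G r b ≡ false) →
                               adj G a b ≡ true → RowsIndepOn G (C ∪ ⁅ b ⁆) (R ∪ ⁅ a ⁆)
  RowsIndepOn-addPivotColumn {C} {R} {a} {b} indep R∌b ab S S⊆ sums =
    indep S S⊆R (λ w w∈C → sums w (x∈p∪q⁺ (inj₁ w∈C)))
    where
      a∉S : a ∉ S
      a∉S = xorsum-pivot S (λ v → adj G v b) ab pivot (sums b (x∈p∪q⁺ (inj₂ (x∈⁅x⁆ b))))
        where
          pivot : ∀ v → v ∈ S → adj G v b ≡ true → v ≡ a
          pivot v v∈S vb with ∪⁅⁆⁻ R (S⊆ v∈S)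
          ... | inj₁ v∈R = contradiction (trans (≡-sym vb) (R∌b v v∈R)) λ ()
          ... | inj₂ v≡a = v≡a
      S⊆R : S ⊆ R
      S⊆R {v} v∈S with ∪⁅⁆⁻ R (S⊆ v∈S)
      ... | inj₁ v∈R  = v∈R
      ... | inj₂ refl = contradiction v∈S a∉S

  RowsIndepOn-addPivotRow : ∀ {C R x v} → RowsIndepOn G C R → (∀ w → w ∈ C → adj G x w ≡ false) →
                            adj G x v ≡ true → RowsIndepOn G (C ∪ ⁅ v ⁆) (R ∪ ⁅ x ⁆)
  RowsIndepOn-addPivotRow {C} {R} {x} {v} indep x∌C xv S S⊆ sums = S-empty
    where
      S-x⊆R : S - x ⊆ R
      S-x⊆R {y} y∈ with ∪⁅⁆⁻ R (S⊆ (p─q⊆p S ⁅ x ⁆ y∈))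
      ... | inj₁ y∈R  = y∈R
      ... | inj₂ refl = contradiction y∈ (x∉p-x S y)
      -- Row x vanishes on C, so removing it from S leaves the sums over C unchanged.
      sums-on-C : ∀ w → w ∈ C → xorsum (S - x) (λ y → adj G y w) ≡ false
      sums-on-C w w∈C =
        trans (xorsum-cong (S - x) S _ (λ y y∈ _ → p─q⊆p S ⁅ x ⁆ y∈) only-y≢x) (sums w (x∈p∪q⁺ (inj₁ w∈C)))
        where
          only-y≢x : ∀ y → y ∈ S → adj G y w ≡ true → y ∈ S - x
          only-y≢x y y∈S yw = x∈p∧x≢y⇒x∈p-y y∈S λ { refl → contradiction (trans (≡-sym yw) (x∌C w w∈C)) λ () }
      S-x-empty : ∀ y → y ∉ S - x
      S-x-empty = indep (S - x) S-x⊆R sums-on-C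
      only-x : ∀ y → y ∈ S → y ≡ x
      only-x y y∈S with y ≟ x
      ... | yes y≡x = y≡x
      ... | no y≢x  = contradiction (x∈p∧x≢y⇒x∈p-y y∈S y≢x) (S-x-empty y)
      S-empty : ∀ y → y ∉ S
      S-empty y y∈S with only-x y y∈S
      ... | refl = xorsum-pivot S (λ y → adj G y v) xv (λ y y∈S _ → only-x y y∈S)
                     (sums v (x∈p∪q⁺ (inj₂ (x∈⁅x⁆ v)))) y∈S

-- A certificate that the cut-rank of X is at least ∣ R ∣.
record CutWitness (G : Graph) (X : Fin (n G) → Set) (R C : Subset (n G)) : Set where
  field
    rows⊆X  : ∀ v → v ∈ R → X v
    cols⊆∁X : ∀ w → w ∈ C → ¬ X w
    indep   : RowsIndepOn G C R

module _ {G : Graph} {X : Fin (n G) → Set} where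

  CutWitness-⊥ : CutWitness G X ⊥ ⊥
  CutWitness-⊥ = record
    { rows⊆X  = λ v v∈⊥ → contradiction v∈⊥ ∉⊥
    ; cols⊆∁X = λ w w∈⊥ → contradiction w∈⊥ ∉⊥
    ; indep   = RowsIndepOn-⊥ G ⊥
    }

  CutWitness⇒∣R∣≤ : ∀ {k R C} → CutRankLe G X k → CutWitness G X R C → ∣ R ∣ ≤ k
  CutWitness⇒∣R∣≤ cutrank≤k W =
    cutrank≤k _ rows⊆X λ S S⊆R sums → indep S S⊆R λ w w∈C → sums w (cols⊆∁X w w∈C)
    where open CutWitness W

  CutWitness-addPivotColumn : ∀ {R C a b} → CutWitness G X R C → (∀ r → r ∈ R → adj G r b ≡ false) →
                              X a → ¬ X b → adj G a b ≡ true → CutWitness G X (R ∪ ⁅ a ⁆) (C ∪ ⁅ b ⁆)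
  CutWitness-addPivotColumn W R∌b Xa ¬Xb ab = record
    { rows⊆X  = ∀-∪⁅⁆ rows⊆X Xa
    ; cols⊆∁X = ∀-∪⁅⁆ cols⊆∁X ¬Xb
    ; indep   = RowsIndepOn-addPivotColumn G indep R∌b ab
    }
    where open CutWitness W

  CutWitness-addPivotRow : ∀ {R C x v} → CutWitness G X R C → (∀ w → w ∈ C → adj G x w ≡ false) →
                           X x → ¬ X v → adj G x v ≡ true → CutWitness G X (R ∪ ⁅ x ⁆) (C ∪ ⁅ v ⁆)
  CutWitness-addPivotRow W x∌C Xx ¬Xv xv = record
    { rows⊆X  = ∀-∪⁅⁆ rows⊆X Xx
    ; cols⊆∁X = ∀-∪⁅⁆ cols⊆∁X ¬Xv
    ; indep   = RowsIndepOn-addPivotRow G indep x∌C xv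
    }
    where open CutWitness W

module Greedy (G : Graph) {d : ℕ} (αloc : αlocLe G d) where
  open Neighbourhood G

  ∣J∣≤d+∣J─N∣ : ∀ {J} → Independent G J → ∀ w → ∣ J ∣ ≤ d + ∣ J ─ N w ∣
  ∣J∣≤d+∣J─N∣ {J} J-indep w = ≤-trans (∣p∣≤∣q∣+∣r∣ split) (+-monoˡ-≤ _ ∣J∩N∣≤d)
    where
      split : J ⊆ (J ∩ N w) ∪ (J ─ N w)
      split {x} x∈J with x ∈? N w
      ... | yes x∈N = x∈p∪q⁺ (inj₁ (x∈p∩q⁺ (x∈J , x∈N)))
      ... | no x∉N  = x∈p∪q⁺ (inj₂ (x∈p∧x∉q⇒x∈p─q x∈J x∉N))
      ∣J∩N∣≤d : ∣ J ∩ N w ∣ ≤ d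
      ∣J∩N∣≤d = αloc w (J ∩ N w) (p∩q⊆q J (N w) , Independent-⊆ G (p∩q⊆p J (N w)) J-indep)

  -- Greedy selection: pick v ∈ J, grow the invariant by a pair found at v and recurse on J ─ N[w];
  -- as J is independent, α-loc ≤ d makes each round discard at most d of its vertices.
  module _ {J₀ : Subset (n G)} (J₀-indep : Independent G J₀)
           (Inv : Subset (n G) → Subset (n G) → Subset (n G) → Set)
           (Inv-⊥ : ∀ J → Inv J ⊥ ⊥)
           (Inv-grow : ∀ {J} → J ⊆ J₀ → ∀ {v} → v ∈ J → ∃[ w ] (∀ {R C} → Inv (J ─ N w) R C →
                         ∃₂ λ R′ C′ → Inv J R′ C′ × ∣ R ∣ < ∣ R′ ∣))
    where

    greedy : ∀ q {J} → J ⊆ J₀ → d * q < ∣ J ∣ → ∃₂ λ R C → Inv J R C × q < ∣ R ∣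
    greedy-─N : ∀ q {J} → J ⊆ J₀ → d * q < ∣ J ∣ → ∀ w → ∃₂ λ R C → Inv (J ─ N w) R C × q ≤ ∣ R ∣

    greedy q {J} J⊆J₀ dq<∣J∣
      with v , v∈J ← 0<∣p∣⇒Nonempty (≤-<-trans z≤n dq<∣J∣)
      with w , grow ← Inv-grow J⊆J₀ v∈J
      with R , C , inv , q≤∣R∣ ← greedy-─N q J⊆J₀ dq<∣J∣ w
      with R′ , C′ , inv′ , ∣R∣<∣R′∣ ← grow inv
      = R′ , C′ , inv′ , ≤-<-trans q≤∣R∣ ∣R∣<∣R′∣

    greedy-─N zero    _ _ _ = ⊥ , ⊥ , Inv-⊥ _ , z≤n
    greedy-─N (suc q) {J} J⊆J₀ dq<∣J∣ w =
      greedy q (⊆-trans (p─q⊆p J (N w)) J⊆J₀) (+-cancelˡ-< d _ _ (begin-strict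
        d + d * q       ≡⟨ *-suc d q ⟨
        d * suc q       <⟨ dq<∣J∣ ⟩
        ∣ J ∣           ≤⟨ ∣J∣≤d+∣J─N∣ (Independent-⊆ G J⊆J₀ J₀-indep) w ⟩
        d + ∣ J ─ N w ∣ ∎))
      where open ≤-Reasoning

    greedy-bound : ∀ {k} → (∀ {J R C} → Inv J R C → ∣ R ∣ ≤ k) → ∣ J₀ ∣ ≤ d * k
    greedy-bound {k} ∣R∣≤k = ≮⇒≥ λ dk<∣J₀∣ →
      let R , C , inv , k<∣R∣ = greedy k ⊆-refl dk<∣J₀∣ in <⇒≱ k<∣R∣ (∣R∣≤k inv)

  module _ {X : Fin (n G) → Set} {k : ℕ} (cutrank≤k : CutRankLe G X k) where

    innerBoundary-≤ : ∀ {J} → Independent G J → (∀ v → v ∈ J → X v × HasNeighbour G (¬_ ∘ X) v) → ∣ J ∣ ≤ d * k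
    innerBoundary-≤ {J₀} J₀-indep boundary =
      greedy-bound J₀-indep Inv (λ J → ⊆-min J , CutWitness-⊥) grow
        (CutWitness⇒∣R∣≤ cutrank≤k ∘ proj₂)
      where
        Inv : Subset (n G) → Subset (n G) → Subset (n G) → Set
        Inv J R C = R ⊆ J × CutWitness G X R C

        extend : ∀ {J R C a b} → a ∈ J → X a → ¬ X b → adj G a b ≡ true → Inv (J ─ N b) R C →
                 Inv J (R ∪ ⁅ a ⁆) (C ∪ ⁅ b ⁆) × ∣ R ∣ < ∣ R ∪ ⁅ a ⁆ ∣
        extend {J} {R} {C} {a} {b} a∈J Xa ¬Xb ab (R⊆J─N , W) =
          (∪⁅⁆-⊆ (⊆-trans R⊆J─N (p─q⊆p J (N b))) a∈J , CutWitness-addPivotColumn W R∌b Xa ¬Xb ab)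
          , ∣p∣<∣p∪⁅x⁆∣ a∉R
          where
            R∌b : ∀ r → r ∈ R → adj G r b ≡ false
            R∌b r r∈R = trans (sym G r b) (∉N⇒¬adj (x∈p─q⇒x∉q J (N b) (R⊆J─N r∈R)))
            a∉R : a ∉ R
            a∉R a∈R = x∈p─q⇒x∉q J (N b) (R⊆J─N a∈R) (adj⇒∈N (trans (sym G b a) ab))

        grow : ∀ {J} → J ⊆ J₀ → ∀ {a} → a ∈ J → ∃[ b ] (∀ {R C} → Inv (J ─ N b) R C →
                 ∃₂ λ R′ C′ → Inv J R′ C′ × ∣ R ∣ < ∣ R′ ∣)
        grow J⊆J₀ {a} a∈J with Xa , b , ¬Xb , ab ← boundary a (J⊆J₀ a∈J) =
          b , λ inv → _ , _ , extend a∈J Xa ¬Xb ab inv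

    outerBoundary-≤ : ∀ {J} → Independent G J → (∀ v → v ∈ J → ¬ X v × HasNeighbour G X v) → ∣ J ∣ ≤ d * k
    outerBoundary-≤ {J₀} J₀-indep boundary =
      greedy-bound J₀-indep Inv (λ J → ⊆-min J , (λ r r∈⊥ → contradiction r∈⊥ ∉⊥) , CutWitness-⊥) grow
        (CutWitness⇒∣R∣≤ cutrank≤k ∘ proj₂ ∘ proj₂)
      where
        Inv : Subset (n G) → Subset (n G) → Subset (n G) → Set
        Inv J R C = C ⊆ J × (∀ r → r ∈ R → ∃[ c ] (c ∈ C × adj G r c ≡ true)) × CutWitness G X R C

        extend : ∀ {J R C v x} → v ∈ J → ¬ X v → X x → adj G x v ≡ true → Inv (J ─ N x) R C →
                 Inv J (R ∪ ⁅ x ⁆) (C ∪ ⁅ v ⁆) × ∣ R ∣ < ∣ R ∪ ⁅ x ⁆ ∣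
        extend {J} {R} {C} {v} {x} v∈J ¬Xv Xx xv (C⊆J─N , matched , W) =
          (∪⁅⁆-⊆ (⊆-trans C⊆J─N (p─q⊆p J (N x))) v∈J , matched′ , CutWitness-addPivotRow W x∌C Xx ¬Xv xv)
          , ∣p∣<∣p∪⁅x⁆∣ x∉R
          where
            x∌C : ∀ c → c ∈ C → adj G x c ≡ false
            x∌C c c∈C = ∉N⇒¬adj (x∈p─q⇒x∉q J (N x) (C⊆J─N c∈C))
            x∉R : x ∉ R
            x∉R x∈R with c , c∈C , xc ← matched x x∈R = contradiction (trans (≡-sym xc) (x∌C c c∈C)) λ ()
            matched′ : ∀ r → r ∈ R ∪ ⁅ x ⁆ → ∃[ c ] (c ∈ C ∪ ⁅ v ⁆ × adj G r c ≡ true)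
            matched′ = ∀-∪⁅⁆ (λ r r∈R → map₂ (map₁ (x∈p∪q⁺ ∘ inj₁)) (matched r r∈R))
                             (v , x∈p∪q⁺ (inj₂ (x∈⁅x⁆ v)) , xv)

        grow : ∀ {J} → J ⊆ J₀ → ∀ {v} → v ∈ J → ∃[ x ] (∀ {R C} → Inv (J ─ N x) R C →
                 ∃₂ λ R′ C′ → Inv J R′ C′ × ∣ R ∣ < ∣ R′ ∣)
        grow J⊆J₀ {v} v∈J with ¬Xv , x , Xx , vx ← boundary v (J⊆J₀ v∈J) =
          x , λ inv → _ , _ , extend v∈J ¬Xv Xx (trans (sym G x v) vx) inv

module RootedTree (T : Tree) where

  parent-rec : (P : Node T → Set) → P zero → (∀ i → P (par T i) → P (suc i)) → ∀ t → P t
  parent-rec P P-root P-child t = go t (<-wellFounded (toℕ t))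
    where
      go : ∀ t → Acc _<_ (toℕ t) → P t
      go zero    _        = P-root
      go (suc i) (acc rs) = P-child i (go (par T i) (rs (s≤s (par< T i))))

  Below-toℕ : ∀ {s t} → Below T s t → toℕ s ≤ toℕ t
  Below-toℕ here           = ≤-refl
  Below-toℕ (there i s≼p) = ≤-trans (Below-toℕ s≼p) (≤-trans (par< T i) (n≤1+n _))

  Below-trans : ∀ {r s t} → Below T r s → Below T s t → Below T r t
  Below-trans r≼s here          = r≼s
  Below-trans r≼s (there i s≼p) = there i (Below-trans r≼s s≼p)

  child⋠parent : ∀ i → ¬ Below T (suc i) (par T i)
  child⋠parent i i≼p = <⇒≱ (s≤s (par< T i)) (Below-toℕ i≼p)

  root-Below : ∀ t → Below T zero t
  root-Below = parent-rec (Below T zero) here there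

  Below? : ∀ s t → Dec (Below T s t)
  Below? s = parent-rec (λ t → Dec (Below T s t)) root? child?
    where
      root? : Dec (Below T s zero)
      root? with s ≟ zero
      ... | yes refl = yes here
      ... | no s≢0   = no λ { here → s≢0 refl }
      child? : ∀ i → Dec (Below T s (par T i)) → Dec (Below T s (suc i))
      child? i _          with s ≟ suc i
      child? i _          | yes refl = yes here
      child? i (yes s≼p)  | no _     = yes (there i s≼p)
      child? i (no s⋠p)   | no s≢i   = no λ { here → s≢i refl ; (there .i s≼p) → s⋠p s≼p }

  Below-child : ∀ {s t} → Below T s t → t ≢ s → ∃[ i ] (par T i ≡ s × Below T (suc i) t)
  Below-child here ne = contradiction refl ne
  Below-child {s} (there i s≼p) _ with par T i ≟ s
  ... | yes p≡s = i , p≡s , here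
  ... | no p≢s  = map₂ (map₂ (there i)) (Below-child s≼p p≢s)

  Below-linear : ∀ {a b t} → Below T a t → Below T b t → Below T a b ⊎ Below T b a
  Below-linear here          b≼t           = inj₂ b≼t
  Below-linear (there i a≼p) here          = inj₁ (there i a≼p)
  Below-linear (there i a≼p) (there .i b≼p) = Below-linear a≼p b≼p

  Below-sibling : ∀ {i j t} → par T i ≡ par T j → Below T (suc i) t → Below T (suc j) t → i ≡ j
  Below-sibling {i} {j} pi≡pj i≼t j≼t with Below-linear i≼t j≼t
  ... | inj₁ here           = refl
  ... | inj₁ (there .j i≼p) = contradiction (subst (Below T (suc i)) (≡-sym pi≡pj) i≼p) (child⋠parent i)
  ... | inj₂ here           = refl
  ... | inj₂ (there .i j≼p) = contradiction (subst (Below T (suc j)) pi≡pj j≼p) (child⋠parent j)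

  module _ {P : Node T → Set} where

    TAdj-sym : ∀ {s t} → TAdj T s t → TAdj T t s
    TAdj-sym (inj₁ e) = inj₂ e
    TAdj-sym (inj₂ e) = inj₁ e

    _∷ʳʷ_ : ∀ {a b c} → WalkIn T P a b → TAdj T b c × P c → WalkIn T P a c
    []       ∷ʳʷ step = step ∷ []
    (s ∷ w) ∷ʳʷ step = s ∷ (w ∷ʳʷ step)

    _++ʷ_ : ∀ {a b c} → WalkIn T P a b → WalkIn T P b c → WalkIn T P a c
    []      ++ʷ w′ = w′
    (s ∷ w) ++ʷ w′ = s ∷ (w ++ʷ w′)

    reverseʷ : ∀ {a b} → P a → WalkIn T P a b → WalkIn T P b a
    reverseʷ Pa []              = []
    reverseʷ Pa ((s , Pu) ∷ w) = reverseʷ Pu w ∷ʳʷ (TAdj-sym s , Pa)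

    descend : ∀ {s t} → Below T s t → (∀ u → Below T s u → Below T u t → P u) → WalkIn T P s t
    descend here          P-between = []
    descend (there i s≼p) P-between =
      descend s≼p (λ u s≼u u≼p → P-between u s≼u (there i u≼p))
        ∷ʳʷ (inj₂ (i , refl , refl) , P-between (suc i) (there i s≼p) here)

  CommonChild : Node T → Node T → Node T → Set
  CommonChild x a b = ∃[ i ] (par T i ≡ x × Below T (suc i) a × Below T (suc i) b)

  -- In the rooted tree, x lies on the path between a and b iff x is an ancestor of a or of b
  -- but no child of x is an ancestor of both.
  OnPath : Node T → Node T → Node T → Set
  OnPath x a b = (Below T x a ⊎ Below T x b) × ¬ CommonChild x a b

  OnPath? : ∀ x a b → Dec (OnPath x a b)
  OnPath? x a b = (Below? x a ⊎-dec Below? x b) ×-dec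
                  ¬? (any? λ i → (par T i ≟ x) ×-dec Below? (suc i) a ×-dec Below? (suc i) b)

  OnPath-sym : ∀ {x a b} → OnPath x a b → OnPath x b a
  OnPath-sym (x≼a⊎x≼b , no-common) = swap x≼a⊎x≼b , λ (i , p≡x , i≼b , i≼a) → no-common (i , p≡x , i≼a , i≼b)

  OnPath-endʳ : ∀ a b → OnPath b a b
  OnPath-endʳ a b =
    inj₂ here , λ (i , p≡b , _ , i≼b) → child⋠parent i (subst (Below T (suc i)) (≡-sym p≡b) i≼b)

  CommonChild-lift : ∀ {s y a b} → Below T s y → CommonChild y a b → CommonChild s a b
  CommonChild-lift {s} s≼y (i , p≡y , i≼a , i≼b) =
    let j , pj≡s , j≼i = Below-child s≼i i≢s in j , pj≡s , Below-trans j≼i i≼a , Below-trans j≼i i≼b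
    where
      s≼i : Below T s (suc i)
      s≼i = there i (subst (Below T s) (≡-sym p≡y) s≼y)
      i≢s : suc i ≢ s
      i≢s refl = child⋠parent i (subst (Below T (suc i)) (≡-sym p≡y) s≼y)

  OnPath-descend : ∀ {s y a b} → Below T s y → Below T y a → OnPath s a b → OnPath y a b
  OnPath-descend s≼y y≼a (_ , no-common) = inj₁ y≼a , no-common ∘ CommonChild-lift s≼y

  OnPath-parent : ∀ {i a b} → ¬ Below T (suc i) a → OnPath (suc i) a b → OnPath (par T i) a b
  OnPath-parent {i} {a} {b} i⋠a (i≼a⊎i≼b , _) =
    inj₂ (Below-trans (there i here) i≼b) ,
    λ (j , pj≡pi , j≼a , j≼b) → i⋠a (subst (λ c → Below T (suc c) a) (Below-sibling pj≡pi j≼b i≼b) j≼a)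
    where
      i≼b : Below T (suc i) b
      i≼b = [ (λ i≼a → contradiction i≼a i⋠a) , (λ i≼b → i≼b) ]′ i≼a⊎i≼b

  children : Node T → List (Fin (m T))
  children t = filter (λ i → par T i ≟ t) (allFin (m T))

  hasParent : Node T → ℕ
  hasParent zero    = 0
  hasParent (suc _) = 1

  degree-≡ : ∀ t → degree T t ≡ length (children t) + hasParent t
  degree-≡ zero    = refl
  degree-≡ (suc _) = refl

  ∈-children⁺ : ∀ {i t} → par T i ≡ t → i ∈ₗ children t
  ∈-children⁺ {i} {t} p≡t = ∈-filter⁺ (λ i → par T i ≟ t) (∈-allFin i) p≡t

  ∈-children⁻ : ∀ {i t} → i ∈ₗ children t → par T i ≡ t
  ∈-children⁻ {t = t} i∈ = proj₂ (∈-filter⁻ (λ i → par T i ≟ t) {xs = allFin (m T)} i∈)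

  interior⇒2≤degree : ∀ {t a b} → Below T t a → a ≢ t → b ≢ t →
              ¬ CommonChild t a b → 2 ≤ degree T t
  interior⇒2≤degree {t} {a} {b} t≼a a≢t b≢t no-common with i , pi≡t , i≼a ← Below-child t≼a a≢t | Below? t b
  ... | yes t≼b with j , pj≡t , j≼b ← Below-child t≼b b≢t =
    subst (2 ≤_) (≡-sym (degree-≡ t))
      (≤-trans (∈-∈-≢⇒2≤length (∈-children⁺ pi≡t) (∈-children⁺ pj≡t) i≢j) (m≤m+n _ _))
    where
      i≢j : i ≢ j
      i≢j refl = no-common (i , pi≡t , i≼a , j≼b)
  interior⇒2≤degree {zero}  _ _ _ _ | no t⋠b = contradiction (root-Below _) t⋠b
  interior⇒2≤degree {suc t} _ _ _ _ | no _   = +-monoˡ-≤ 1 (∈-length (∈-children⁺ pi≡t))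

  OnPath-leaf : ∀ {t a b} → degree T t ≤ 1 → OnPath t a b → a ≡ t ⊎ b ≡ t
  OnPath-leaf {t} {a} {b} deg≤1 on-path@(t≼a⊎t≼b , no-common) with a ≟ t | b ≟ t | t≼a⊎t≼b
  ... | yes a≡t | _       | _       = inj₁ a≡t
  ... | no _    | yes b≡t | _       = inj₂ b≡t
  ... | no a≢t  | no b≢t  | inj₁ t≼a = contradiction deg≤1 (<⇒≱ (interior⇒2≤degree t≼a a≢t b≢t no-common))
  ... | no a≢t  | no b≢t  | inj₂ t≼b =
    contradiction deg≤1 (<⇒≱ (interior⇒2≤degree t≼b b≢t a≢t (proj₂ (OnPath-sym on-path))))

module FromRankDecomposition (G : Graph) (D : RankDecomposition G) where
  open Neighbourhood G
  open RootedTree (tree D)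

  T : Tree
  T = tree D

  ℓ : Fin (n G) → Node T
  ℓ = leaf D

  -- v ∈ bags t iff t lies on the subtree of T spanned by the leaves of N[v].
  InBag : Node T → Fin (n G) → Set
  InBag t v = ∃[ u ] (u ∈ N v × OnPath t (ℓ v) (ℓ u))

  InBag? : ∀ t → Decidable (InBag t)
  InBag? t v = any? λ u → (u ∈? N v) ×-dec OnPath? t (ℓ v) (ℓ u)

  bags : Node T → Subset (n G)
  bags t = ⟦ InBag? t ⟧

  ∈bags⁺ : ∀ {t v} → InBag t v → v ∈ bags t
  ∈bags⁺ {t} = ∈⟦⟧⁺ (InBag? t)

  ∈bags⁻ : ∀ {t v} → v ∈ bags t → InBag t v
  ∈bags⁻ {t} = ∈⟦⟧⁻ (InBag? t)

  BagWalk : Fin (n G) → Node T → Node T → Set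
  BagWalk v = WalkIn T (λ t → v ∈ bags t)

  walk-to-leaf : ∀ v s → InBag s v → BagWalk v s (ℓ v)
  walk-to-leaf v = parent-rec (λ s → InBag s v → BagWalk v s (ℓ v))
                              (descend-to-leaf (root-Below _)) ascend-or-descend
    where
      descend-to-leaf : ∀ {s} → Below T s (ℓ v) → InBag s v → BagWalk v s (ℓ v)
      descend-to-leaf s≼v (u , u∈N , on-path) =
        descend s≼v λ y s≼y y≼v → ∈bags⁺ (u , u∈N , OnPath-descend s≼y y≼v on-path)
      ascend-or-descend : ∀ i → (InBag (par T i) v → BagWalk v (par T i) (ℓ v)) →
                          InBag (suc i) v → BagWalk v (suc i) (ℓ v)
      ascend-or-descend i from-parent in-bag with Below? (suc i) (ℓ v)
      ... | yes i≼v = descend-to-leaf i≼v in-bag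
      ... | no i⋠v  = let u , u∈N , on-path = in-bag
                          in-parent = u , u∈N , OnPath-parent i⋠v on-path
                      in  (inj₁ (i , refl , refl) , ∈bags⁺ in-parent) ∷ from-parent in-parent

  decomposition : TreeDecomposition G
  decomposition = record
    { tree           = T
    ; bag            = bags
    ; cover-vertices = λ v → ℓ v , ∈bags⁺ (v , v∈N[v] v , OnPath-endʳ (ℓ v) (ℓ v))
    ; cover-edges    = λ u v uv → ℓ u , ∈bags⁺ (u , v∈N[v] u , OnPath-endʳ (ℓ u) (ℓ u))
                                      , ∈bags⁺ (u , adj⇒∈N (trans (sym G v u) uv) , OnPath-endʳ (ℓ v) (ℓ u))
    ; connected      = λ v s t s∋v t∋v →
        walk-to-leaf v s (∈bags⁻ s∋v) ++ʷ reverseʷ t∋v (walk-to-leaf v t (∈bags⁻ t∋v))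
    }

  LeafBelow : Node T → Fin (n G) → Set
  LeafBelow s v = Below T s (ℓ v)

  under : Node T → Subset (n G)
  under s = ⟦ (λ v → Below? s (ℓ v)) ⟧

  ∈under⁺ : ∀ {s v} → LeafBelow s v → v ∈ under s
  ∈under⁺ {s} = ∈⟦⟧⁺ (λ v → Below? s (ℓ v))

  ∈under⁻ : ∀ {s v} → v ∈ under s → LeafBelow s v
  ∈under⁻ {s} = ∈⟦⟧⁻ (λ v → Below? s (ℓ v))

  leaf-bag⊆N : ∀ {t w} → degree T t ≤ 1 → ℓ w ≡ t → bags t ⊆ N w
  leaf-bag⊆N {t} {w} deg≤1 ℓw≡t {v} v∈bag
    with u , u∈N , on-path ← ∈bags⁻ v∈bag
    with OnPath-leaf deg≤1 on-path
  ... | inj₁ ℓv≡t = subst (λ z → v ∈ N z) (leaf-inj D (trans ℓv≡t (≡-sym ℓw≡t))) (v∈N[v] v)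
  ... | inj₂ ℓu≡t = subst (λ z → v ∈ N z) (leaf-inj D (trans ℓu≡t (≡-sym ℓw≡t))) (∈N-sym u∈N)

  module _ {d k : ℕ} (αloc : αlocLe G d) (width≤k : widthLe D k) where
    open Greedy G αloc

    leaf-bag-α≤ : ∀ {t m} → d ≤ m → degree T t ≤ 1 → αLe G (bags t) m
    leaf-bag-α≤ {t} d≤m deg≤1 I (I⊆bag , I-indep) =
      let w , ℓw≡t = leaf-onto D t deg≤1
      in  ≤-trans (αloc w I (⊆-trans I⊆bag (leaf-bag⊆N deg≤1 ℓw≡t) , I-indep)) d≤m

    child-part-≤ : ∀ {t I i} → Independent G I → I ⊆ bags t → i ∈ₗ children t →
                   ∣ I ∩ under (suc i) ∣ ≤ d * k
    child-part-≤ {t} {I} {i} I-indep I⊆bag i∈ =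
      innerBoundary-≤ (width≤k i) (Independent-⊆ G (p∩q⊆p I _) I-indep) boundary
      where
        boundary : ∀ v → v ∈ I ∩ under (suc i) →
                   LeafBelow (suc i) v × HasNeighbour G (¬_ ∘ LeafBelow (suc i)) v
        boundary v v∈
          with v∈I , v∈under ← x∈p∩q⁻ I _ v∈
          with u , u∈N , _ , no-common ← ∈bags⁻ (I⊆bag v∈I) =
          i≼v , u , i⋠u , ∈N⇒adj u∈N λ { refl → i⋠u i≼v }
          where
            i≼v = ∈under⁻ v∈under
            i⋠u = λ i≼u → no-common (i , ∈-children⁻ i∈ , i≼v , i≼u)

    parent-part-≤ : ∀ t {I} → Independent G I → I ⊆ bags t →
                    ∣ I ─ under t ∣ ≤ hasParent t * (d * k)
    parent-part-≤ zero {I} _ _ =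
      subst (∣ I ─ under zero ∣ ≤_) (∣⊥∣≡0 (n G)) (p⊆q⇒∣p∣≤∣q∣ {q = ⊥} λ v∈ →
        contradiction (∈under⁺ (root-Below _)) (x∈p─q⇒x∉q I (under zero) v∈))
    parent-part-≤ (suc j) {I} I-indep I⊆bag =
      subst (∣ I ─ under (suc j) ∣ ≤_) (≡-sym (+-identityʳ (d * k)))
        (outerBoundary-≤ (width≤k j) (Independent-⊆ G (p─q⊆p I _) I-indep) boundary)
      where
        boundary : ∀ v → v ∈ I ─ under (suc j) →
                   ¬ LeafBelow (suc j) v × HasNeighbour G (LeafBelow (suc j)) v
        boundary v v∈ with u , u∈N , j≼v⊎j≼u , _ ← ∈bags⁻ (I⊆bag (p─q⊆p I _ v∈)) =
          j⋠v , u , j≼u , ∈N⇒adj u∈N λ { refl → j⋠v j≼u }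
          where
            j⋠v = x∈p─q⇒x∉q I (under (suc j)) v∈ ∘ ∈under⁺
            j≼u = [ (λ j≼v → contradiction j≼v j⋠v) , (λ j≼u → j≼u) ]′ j≼v⊎j≼u

    inner-bag-α≤ : ∀ {t} → (∀ v → ℓ v ≢ t) → αLe G (bags t) (degree T t * (d * k))
    inner-bag-α≤ {t} not-leaf I (I⊆bag , I-indep) = begin
      ∣ I ∣                                                  ≤⟨ ∣p∣≤∣q∣+∣r∣ cover ⟩
      ∣ ⋃ (List.map part (children t)) ∣ + ∣ I ─ under t ∣
        ≤⟨ +-mono-≤ children-≤ (parent-part-≤ t I-indep I⊆bag) ⟩
      length (List.map part (children t)) * (d * k) + hasParent t * (d * k)
        ≡⟨ cong (λ l → l * (d * k) + hasParent t * (d * k)) (length-map part (children t)) ⟩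
      length (children t) * (d * k) + hasParent t * (d * k)
        ≡⟨ *-distribʳ-+ (d * k) (length (children t)) (hasParent t) ⟨
      (length (children t) + hasParent t) * (d * k)          ≡⟨ cong (_* (d * k)) (degree-≡ t) ⟨
      degree T t * (d * k)                                   ∎
      where
        open ≤-Reasoning
        part : Fin (m T) → Subset (n G)
        part i = I ∩ under (suc i)
        children-≤ : ∣ ⋃ (List.map part (children t)) ∣ ≤ length (List.map part (children t)) * (d * k)
        children-≤ = ∣⋃∣≤length* (All.map⁺ (All.tabulate (child-part-≤ I-indep I⊆bag)))
        cover : I ⊆ ⋃ (List.map part (children t)) ∪ (I ─ under t)
        cover {v} v∈I with Below? t (ℓ v)
        ... | yes t≼v = let i , pi≡t , i≼v = Below-child t≼v (not-leaf v) in
          x∈p∪q⁺ (inj₁ (∈⋃⁺ (Any.map⁺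
            (Any.map (λ { refl → x∈p∩q⁺ (v∈I , ∈under⁺ i≼v) }) (∈-children⁺ pi≡t)))))
        ... | no t⋠v  = x∈p∪q⁺ (inj₂ (x∈p∧x∉q⇒x∈p─q v∈I (t⋠v ∘ ∈under⁻)))

open FromRankDecomposition using (T; bags; decomposition; leaf-bag-α≤; inner-bag-α≤)

theorem8p2 : (d k : ℕ) → 1 ≤ d → 1 ≤ k → (G : Graph) →
    αlocLe G d → rwLe G k → αtwLe G (3 * d * k)
theorem8p2 d k _ 1≤k G αloc (D , width≤k) = decomposition G D , bag-α≤
  where
    bag-α≤ : ∀ t → αLe G (bags G D t) (3 * d * k)
    bag-α≤ t with degree (T G D) t ≤? 1
    ... | yes deg≤1 = leaf-bag-α≤ G D αloc width≤k d≤3dk deg≤1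
      where
        d≤3dk : d ≤ 3 * d * k
        d≤3dk = ≤-trans (m≤m+n d _) (m≤m*n (3 * d) k {{>-nonZero 1≤k}})
    ... | no deg≰1 = subst (αLe G (bags G D t)) degree*dk≡3dk (inner-bag-α≤ G D αloc width≤k not-leaf)
      where
        not-leaf : ∀ v → leaf D v ≢ t
        not-leaf v refl = deg≰1 (leaf-isLeaf D v)
        degree*dk≡3dk : degree (T G D) t * (d * k) ≡ 3 * d * k
        degree*dk≡3dk = trans (cong (_* (d * k)) (cubic D t (≰⇒> deg≰1))) (≡-sym (*-assoc 3 d k))
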